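{- Let $G$ be a graph of order $n$ with minimum degree $\delta=\delta(G)$, and let $k\ge 1$ be an integer with $\delta\ge k-1$. Then $L_k(G)\le\gamma_{\times k}(G)$. In particular, if $k\le\delta$, then, writing $\delta'=\delta-k+1$, $$L_k(G)\ \le\ \left(1-\frac{\delta'}{\binom{\delta+1}{k-1}^{1/\delta'}\,(1+\delta')^{1+1/\delta'}}\right)n.$$
   Context: All graphs are finite, simple and undirected. For a vertex $v$, $N[v]$ denotes the closed neighbourhood of $v$. A vertex set $X\subseteq V(G)$ is a $k$-limited packing if $|N[v]\cap X|\le k$ for every $v\in V(G)$; $L_k(G)$ is the maximum size of a $k$-limited packing in $G$. A set $D\subseteq V(G)$ is a $k$-tuple dominating set if $|N[v]\cap D|\ge k$ for every $v\in V(G)$; the $k$-tuple domination number $\gamma_{\times k}(G)$ is the minimum size of a $k$-tuple dominating set (defined when $\delta(G)\ge k-1$). $\delta(G)$ is the minimum vertex degree. -}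

module Defs where

open import Data.Nat using (ℕ; suc; _≤_; _≥_; _∸_)
open import Data.Bool using (Bool; true; false; _∨_)
open import Data.Fin using (Fin; _≟_)
open import Data.Fin.Subset using (Subset; inside; outside; _∩_; ∣_∣)
open import Data.Vec using (tabulate)
open import Data.Product using (∃; _×_)
open import Relation.Binary.PropositionalEquality using (_≡_)
open import Relation.Nullary.Decidable using (⌊_⌋)

record Graph (n : ℕ) : Set where
  field
    adj   : Fin n → Fin n → Bool
    sym   : ∀ u v → adj u v ≡ adj v u
    irrefl : ∀ v → adj v v ≡ false
open Graph public

toSide : Bool → Data.Fin.Subset.Side
toSide true  = inside
toSide false = outside

N⟨_⟩ : ∀ {n} → Graph n → Fin n → Subset n
N⟨ G ⟩ v = tabulate (λ u → toSide (adj G v u))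

N[_] : ∀ {n} → Graph n → Fin n → Subset n
N[ G ] v = tabulate (λ u → toSide (⌊ u ≟ v ⌋ ∨ adj G v u))

deg : ∀ {n} → Graph n → Fin n → ℕ
deg G v = ∣ N⟨ G ⟩ v ∣

IsMinDegree : ∀ {n} → Graph n → ℕ → Set
IsMinDegree {n} G δ = (∀ v → δ ≤ deg G v) × ∃ λ (v : Fin n) → deg G v ≡ δ

IsLimitedPacking : ∀ {n} → Graph n → ℕ → Subset n → Set
IsLimitedPacking G k X = ∀ v → ∣ N[ G ] v ∩ X ∣ ≤ k

IsTupleDominating : ∀ {n} → Graph n → ℕ → Subset n → Set
IsTupleDominating G k D = ∀ v → ∣ N[ G ] v ∩ D ∣ ≥ k

IsLk : ∀ {n} → Graph n → ℕ → ℕ → Set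
IsLk {n} G k L = (∃ λ (X : Subset n) → IsLimitedPacking G k X × ∣ X ∣ ≡ L)
               × (∀ X → IsLimitedPacking G k X → ∣ X ∣ ≤ L)

IsGammaTuple : ∀ {n} → Graph n → ℕ → ℕ → Set
IsGammaTuple {n} G k γ = (∃ λ (D : Subset n) → IsTupleDominating G k D × ∣ D ∣ ≡ γ)
                       × (∀ D → IsTupleDominating G k D → γ ≤ ∣ D ∣)

-- Double counting the pairs (v, u) with u ∈ N[v], u ∈ X and v ∈ Y, where X is a k-limited packing and
-- every closed neighbourhood meets Y in at least m vertices, gives m ∣X∣ ≤ k ∣Y∣. Taking Y a k-tuple
-- dominating set (m = k) yields L_k ≤ γ_{×k}; taking Y = V (m = δ + 1) yields (δ + 1) L_k ≤ k n, i.e.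
-- δ' n ≤ (δ + 1)(n − L_k). The bound (δ + 1)^(δ'+1) ≤ C(δ + 1, k − 1) (δ' + 1)^(δ'+1), an instance of
-- m^e ≤ C(m, e) e^e, then gives the power form of the upper bound.
module Submission where

open import Defs hiding (sym)
open import Data.Bool using (Bool; true; false; _∨_)
open import Data.Fin using (Fin; zero; suc; _≟_)
open import Data.Fin.Subset using (Subset; _∩_; ∣_∣; ⊤)
open import Data.Fin.Subset.Properties using (∣⊤∣≡n; ∩-identityʳ)
open import Data.Nat using (ℕ; zero; suc; _≤_; _+_; _*_; _∸_; _^_; z≤n; s≤s; NonZero; >-nonZero)
open import Data.Nat.Combinatorics using (_C_; nCk+nC[k+1]≡[n+1]C[k+1]; nCk≡nC[n∸k]; nC1≡n)
open import Data.Nat.Properties hiding (_≟_)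
open import Data.Nat.Tactic.RingSolver using (solve-∀)
open import Algebra.Properties.CommutativeSemigroup *-commutativeSemigroup
  using (x∙yz≈y∙xz; x∙yz≈yx∙z; x∙yz≈z∙yx; xy∙z≈y∙xz) renaming (interchange to *-interchange)
open import Data.Product using (_×_; _,_)
open import Data.Vec using ([]; _∷_; lookup)
open import Data.Vec.Properties using (lookup∘tabulate)
open import Function using (_∘_)
open import Relation.Binary.PropositionalEquality
open import Relation.Nullary using (yes; no; contradiction)
open import Relation.Nullary.Decidable using (⌊_⌋)
open import Algebra.Properties.Semiring.Sum +-*-semiring
  using (sum; sum-syntax; sum-cong-≗; sum-replicate-zero; ∑-distrib-+; ∑-comm; *-distribˡ-sum)

^-distribʳ-* : ∀ m n k → (m * n) ^ k ≡ m ^ k * n ^ k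
^-distribʳ-* m n zero    = refl
^-distribʳ-* m n (suc k) = trans (cong (m * n *_) (^-distribʳ-* m n k)) (*-interchange m n (m ^ k) (n ^ k))

k^k≢0 : ∀ k → NonZero (k ^ k)
k^k≢0 zero    = _
k^k≢0 (suc k) = m^n≢0 (suc k) (suc k)

nC0≡1 : ∀ n → n C 0 ≡ 1
nC0≡1 zero    = refl
nC0≡1 (suc n) = refl

[1+k]*[1+n]C[1+k]≡[1+n]*nCk : ∀ n k → suc k * (suc n C suc k) ≡ suc n * (n C k)
[1+k]*[1+n]C[1+k]≡[1+n]*nCk n zero = begin
  1 * (suc n C 1)  ≡⟨ *-identityˡ _ ⟩
  suc n C 1        ≡⟨ nC1≡n (suc n) ⟩
  suc n            ≡⟨ *-identityʳ (suc n) ⟨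
  suc n * 1        ≡⟨ cong (suc n *_) (nC0≡1 n) ⟨
  suc n * (n C 0)  ∎
  where open ≡-Reasoning
[1+k]*[1+n]C[1+k]≡[1+n]*nCk zero    (suc k) = *-zeroʳ (suc (suc k))
[1+k]*[1+n]C[1+k]≡[1+n]*nCk (suc n) (suc k) = begin
  suc (suc k) * (suc (suc n) C suc (suc k))
    ≡⟨ cong (suc (suc k) *_) (nCk+nC[k+1]≡[n+1]C[k+1] (suc n) (suc k)) ⟨
  suc (suc k) * (a + suc n C suc (suc k))
    ≡⟨ *-distribˡ-+ (suc (suc k)) a _ ⟩
  a + suc k * a + suc (suc k) * (suc n C suc (suc k))
    ≡⟨ +-assoc a _ _ ⟩
  a + (suc k * a + suc (suc k) * (suc n C suc (suc k)))
    ≡⟨ cong₂ (λ x y → a + (x + y)) ([1+k]*[1+n]C[1+k]≡[1+n]*nCk n k) ([1+k]*[1+n]C[1+k]≡[1+n]*nCk n (suc k)) ⟩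
  a + (suc n * (n C k) + suc n * (n C suc k))
    ≡⟨ cong (a +_) (*-distribˡ-+ (suc n) (n C k) (n C suc k)) ⟨
  a + suc n * (n C k + n C suc k)
    ≡⟨ cong (λ x → a + suc n * x) (nCk+nC[k+1]≡[n+1]C[k+1] n k) ⟩
  suc (suc n) * a
    ∎
  where
  open ≡-Reasoning
  a = suc n C suc k

-- (1 + m) k ≤ (1 + k) m lifts the hypothesis for (m, k) to (1 + m)^k ≤ C(m, k) (1 + k)^k, and the
-- absorption identity supplies the remaining factor (1 + k) / (1 + m).
m^k≤mCk*k^k : ∀ {m k} → k ≤ m → m ^ k ≤ (m C k) * k ^ k
m^k≤mCk*k^k {m} {zero}  _             = ≤-reflexive (cong (_* 1) (sym (nC0≡1 m)))
m^k≤mCk*k^k {suc m} {suc k} (s≤s k≤m) = *-cancelˡ-≤ (suc k) (begin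
  suc k * (suc m * suc m ^ k)                       ≡⟨ x∙yz≈y∙xz (suc k) (suc m) _ ⟩
  suc m * (suc k * suc m ^ k)                       ≤⟨ *-monoʳ-≤ (suc m) (*-monoʳ-≤ (suc k) [1+m]^k≤mCk*[1+k]^k) ⟩
  suc m * (suc k * ((m C k) * suc k ^ k))           ≡⟨ x∙yz≈y∙xz (suc m) (suc k) _ ⟩
  suc k * (suc m * ((m C k) * suc k ^ k))           ≡⟨ cong (suc k *_) (*-assoc (suc m) (m C k) _) ⟨
  suc k * (suc m * (m C k) * suc k ^ k)             ≡⟨ cong (λ c → suc k * (c * suc k ^ k)) ([1+k]*[1+n]C[1+k]≡[1+n]*nCk m k) ⟨
  suc k * (suc k * (suc m C suc k) * suc k ^ k)     ≡⟨ cong (suc k *_) (xy∙z≈y∙xz (suc k) (suc m C suc k) _) ⟩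
  suc k * ((suc m C suc k) * (suc k * suc k ^ k))   ∎)
  where
  open ≤-Reasoning
  [1+m]k≤[1+k]m : suc m * k ≤ suc k * m
  [1+m]k≤[1+k]m = begin
    k + m * k   ≡⟨ cong (k +_) (*-comm m k) ⟩
    k + k * m   ≤⟨ +-monoˡ-≤ (k * m) k≤m ⟩
    m + k * m   ∎
  [1+m]^k≤mCk*[1+k]^k : suc m ^ k ≤ (m C k) * suc k ^ k
  [1+m]^k≤mCk*[1+k]^k = *-cancelʳ-≤ _ _ (k ^ k) {{k^k≢0 k}} (begin
    suc m ^ k * k ^ k               ≡⟨ ^-distribʳ-* (suc m) k k ⟨
    (suc m * k) ^ k                 ≤⟨ ^-monoˡ-≤ k [1+m]k≤[1+k]m ⟩
    (suc k * m) ^ k                 ≡⟨ ^-distribʳ-* (suc k) m k ⟩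
    suc k ^ k * m ^ k               ≤⟨ *-monoʳ-≤ (suc k ^ k) (m^k≤mCk*k^k k≤m) ⟩
    suc k ^ k * ((m C k) * k ^ k)   ≡⟨ x∙yz≈yx∙z (suc k ^ k) (m C k) (k ^ k) ⟩
    (m C k) * suc k ^ k * k ^ k     ∎)

m^k≤mCj*k^k : ∀ {m} k j → k + j ≡ m → m ^ k ≤ (m C j) * k ^ k
m^k≤mCj*k^k {m} k j refl = subst (λ c → m ^ k ≤ c * k ^ k) mCk≡mCj (m^k≤mCk*k^k (m≤m+n k j))
  where
  mCk≡mCj : m C k ≡ m C j
  mCk≡mCj = trans (cong (m C_) (sym (m+n∸n≡m k j))) (sym (nCk≡nC[n∸k] (m≤n+m j k)))

𝟙 : Bool → ℕ
𝟙 true  = 1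
𝟙 false = 0

∣p∣≡∑𝟙 : ∀ {n} (p : Subset n) → ∣ p ∣ ≡ ∑[ i < n ] 𝟙 (lookup p i)
∣p∣≡∑𝟙 []          = refl
∣p∣≡∑𝟙 (true  ∷ p) = cong suc (∣p∣≡∑𝟙 p)
∣p∣≡∑𝟙 (false ∷ p) = ∣p∣≡∑𝟙 p

∣p∩q∣≡∑𝟙*𝟙 : ∀ {n} (p q : Subset n) → ∣ p ∩ q ∣ ≡ ∑[ i < n ] (𝟙 (lookup p i) * 𝟙 (lookup q i))
∣p∩q∣≡∑𝟙*𝟙 []          []          = refl
∣p∩q∣≡∑𝟙*𝟙 (true  ∷ p) (true  ∷ q) = cong suc (∣p∩q∣≡∑𝟙*𝟙 p q)
∣p∩q∣≡∑𝟙*𝟙 (true  ∷ p) (false ∷ q) = ∣p∩q∣≡∑𝟙*𝟙 p q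
∣p∩q∣≡∑𝟙*𝟙 (false ∷ p) (_     ∷ q) = ∣p∩q∣≡∑𝟙*𝟙 p q

∑𝟙*k≡k*∣p∣ : ∀ {n} k (p : Subset n) → ∑[ i < n ] (𝟙 (lookup p i) * k) ≡ k * ∣ p ∣
∑𝟙*k≡k*∣p∣ k []          = sym (*-zeroʳ k)
∑𝟙*k≡k*∣p∣ k (true  ∷ p) = begin
  1 * k + ∑[ i < _ ] (𝟙 (lookup p i) * k) ≡⟨ cong₂ _+_ (*-identityˡ k) (∑𝟙*k≡k*∣p∣ k p) ⟩
  k + k * ∣ p ∣                          ≡⟨ *-suc k ∣ p ∣ ⟨
  k * suc ∣ p ∣                          ∎
  where open ≡-Reasoning
∑𝟙*k≡k*∣p∣ k (false ∷ p) = ∑𝟙*k≡k*∣p∣ k p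

sum-mono-≤ : ∀ {n} {f g : Fin n → ℕ} → (∀ i → f i ≤ g i) → sum f ≤ sum g
sum-mono-≤ {zero}  f≤g = z≤n
sum-mono-≤ {suc n} f≤g = +-mono-≤ (f≤g zero) (sum-mono-≤ (f≤g ∘ suc))

∑𝟙≟≡1 : ∀ {n} (v : Fin n) → ∑[ u < n ] 𝟙 ⌊ u ≟ v ⌋ ≡ 1
∑𝟙≟≡1 {suc n} zero    = cong suc (sum-replicate-zero n)
∑𝟙≟≡1 {suc n} (suc v) = trans (sum-cong-≗ (cong 𝟙 ∘ ⌊suc≟suc⌋)) (∑𝟙≟≡1 v)
  where
  ⌊suc≟suc⌋ : ∀ u → ⌊ suc u ≟ suc v ⌋ ≡ ⌊ u ≟ v ⌋
  ⌊suc≟suc⌋ u with u ≟ v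
  ... | yes _ = refl
  ... | no  _ = refl

module _ {n} (N : Fin n → Subset n) (N-sym : ∀ u v → lookup (N u) v ≡ lookup (N v) u) where

  ∑𝟙*∣N∩∣-swap : ∀ X Y →
    ∑[ v < n ] (𝟙 (lookup Y v) * ∣ N v ∩ X ∣) ≡ ∑[ v < n ] (𝟙 (lookup X v) * ∣ N v ∩ Y ∣)
  ∑𝟙*∣N∩∣-swap X Y = begin
    ∑[ v < n ] (𝟙 (lookup Y v) * ∣ N v ∩ X ∣)     ≡⟨ sum-cong-≗ (expand X Y) ⟩
    ∑[ v < n ] ∑[ u < n ] term Y X v u           ≡⟨ sum-cong-≗ (λ v → sum-cong-≗ (term-sym v)) ⟩
    ∑[ v < n ] ∑[ u < n ] term X Y u v           ≡⟨ ∑-comm (λ v u → term X Y u v) ⟩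
    ∑[ u < n ] ∑[ v < n ] term X Y u v           ≡⟨ sum-cong-≗ (expand Y X) ⟨
    ∑[ u < n ] (𝟙 (lookup X u) * ∣ N u ∩ Y ∣)     ∎
    where
    open ≡-Reasoning
    term : Subset n → Subset n → Fin n → Fin n → ℕ
    term Y X v u = 𝟙 (lookup Y v) * (𝟙 (lookup (N v) u) * 𝟙 (lookup X u))
    expand : ∀ X Y v → 𝟙 (lookup Y v) * ∣ N v ∩ X ∣ ≡ ∑[ u < n ] term Y X v u
    expand X Y v = trans (cong (𝟙 (lookup Y v) *_) (∣p∩q∣≡∑𝟙*𝟙 (N v) X))
                         (*-distribˡ-sum (𝟙 (lookup Y v)) (λ u → 𝟙 (lookup (N v) u) * 𝟙 (lookup X u)))
    term-sym : ∀ v u → term Y X v u ≡ term X Y u v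
    term-sym v u = begin
      𝟙 (lookup Y v) * (𝟙 (lookup (N v) u) * 𝟙 (lookup X u))  ≡⟨ cong (λ b → 𝟙 (lookup Y v) * (𝟙 b * 𝟙 (lookup X u))) (N-sym v u) ⟩
      𝟙 (lookup Y v) * (𝟙 (lookup (N u) v) * 𝟙 (lookup X u))  ≡⟨ x∙yz≈z∙yx (𝟙 (lookup Y v)) (𝟙 (lookup (N u) v)) (𝟙 (lookup X u)) ⟩
      𝟙 (lookup X u) * (𝟙 (lookup (N u) v) * 𝟙 (lookup Y v))  ∎

toSide-id : ∀ b → toSide b ≡ b
toSide-id true  = refl
toSide-id false = refl

module _ {n} (G : Graph n) where

  lookup-N[] : ∀ v u → lookup (N[ G ] v) u ≡ (⌊ u ≟ v ⌋ ∨ adj G v u)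
  lookup-N[] v u = trans (lookup∘tabulate _ u) (toSide-id _)

  N[]-sym : ∀ u v → lookup (N[ G ] u) v ≡ lookup (N[ G ] v) u
  N[]-sym u v = begin
    lookup (N[ G ] u) v      ≡⟨ lookup-N[] u v ⟩
    ⌊ v ≟ u ⌋ ∨ adj G u v    ≡⟨ cong₂ _∨_ ⌊v≟u⌋≡⌊u≟v⌋ (Graph.sym G u v) ⟩
    ⌊ u ≟ v ⌋ ∨ adj G v u    ≡⟨ lookup-N[] v u ⟨
    lookup (N[ G ] v) u      ∎
    where
    open ≡-Reasoning
    ⌊v≟u⌋≡⌊u≟v⌋ : ⌊ v ≟ u ⌋ ≡ ⌊ u ≟ v ⌋
    ⌊v≟u⌋≡⌊u≟v⌋ with v ≟ u | u ≟ v
    ... | yes _   | yes _   = refl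
    ... | no  _   | no  _   = refl
    ... | yes v≡u | no  u≢v = contradiction (sym v≡u) u≢v
    ... | no  v≢u | yes u≡v = contradiction (sym u≡v) v≢u

  ∣N[v]∣≡1+deg : ∀ v → ∣ N[ G ] v ∩ ⊤ ∣ ≡ suc (deg G v)
  ∣N[v]∣≡1+deg v = begin
    ∣ N[ G ] v ∩ ⊤ ∣                                    ≡⟨ cong ∣_∣ (∩-identityʳ (N[ G ] v)) ⟩
    ∣ N[ G ] v ∣                                        ≡⟨ ∣p∣≡∑𝟙 (N[ G ] v) ⟩
    ∑[ u < n ] 𝟙 (lookup (N[ G ] v) u)                 ≡⟨ sum-cong-≗ 𝟙N[v]≡𝟙≟+𝟙adj ⟩
    ∑[ u < n ] (𝟙 ⌊ u ≟ v ⌋ + 𝟙 (adj G v u))           ≡⟨ ∑-distrib-+ (λ u → 𝟙 ⌊ u ≟ v ⌋) (λ u → 𝟙 (adj G v u)) ⟩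
    ∑[ u < n ] 𝟙 ⌊ u ≟ v ⌋ + ∑[ u < n ] 𝟙 (adj G v u)  ≡⟨ cong₂ _+_ (∑𝟙≟≡1 v) (sum-cong-≗ (sym ∘ 𝟙N⟨v⟩≡𝟙adj)) ⟩
    1 + ∑[ u < n ] 𝟙 (lookup (N⟨ G ⟩ v) u)             ≡⟨ cong suc (∣p∣≡∑𝟙 (N⟨ G ⟩ v)) ⟨
    suc (deg G v)                                       ∎
    where
    open ≡-Reasoning
    𝟙N[v]≡𝟙≟+𝟙adj : ∀ u → 𝟙 (lookup (N[ G ] v) u) ≡ 𝟙 ⌊ u ≟ v ⌋ + 𝟙 (adj G v u)
    𝟙N[v]≡𝟙≟+𝟙adj u rewrite lookup-N[] v u with u ≟ v
    ... | yes refl rewrite irrefl G u = refl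
    ... | no  _    = refl
    𝟙N⟨v⟩≡𝟙adj : ∀ u → 𝟙 (lookup (N⟨ G ⟩ v) u) ≡ 𝟙 (adj G v u)
    𝟙N⟨v⟩≡𝟙adj u = cong 𝟙 (trans (lookup∘tabulate _ u) (toSide-id _))

  limitedPacking⇒m*∣X∣≤k*∣Y∣ : ∀ {k m X Y} → IsLimitedPacking G k X →
    (∀ v → m ≤ ∣ N[ G ] v ∩ Y ∣) → m * ∣ X ∣ ≤ k * ∣ Y ∣
  limitedPacking⇒m*∣X∣≤k*∣Y∣ {k} {m} {X} {Y} X-packing m≤∣N[v]∩Y∣ = begin
    m * ∣ X ∣                                     ≡⟨ ∑𝟙*k≡k*∣p∣ m X ⟨
    ∑[ v < n ] (𝟙 (lookup X v) * m)               ≤⟨ sum-mono-≤ (λ v → *-monoʳ-≤ (𝟙 (lookup X v)) (m≤∣N[v]∩Y∣ v)) ⟩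
    ∑[ v < n ] (𝟙 (lookup X v) * ∣ N[ G ] v ∩ Y ∣) ≡⟨ ∑𝟙*∣N∩∣-swap (N[ G ]) N[]-sym X Y ⟨
    ∑[ v < n ] (𝟙 (lookup Y v) * ∣ N[ G ] v ∩ X ∣) ≤⟨ sum-mono-≤ (λ v → *-monoʳ-≤ (𝟙 (lookup Y v)) (X-packing v)) ⟩
    ∑[ v < n ] (𝟙 (lookup Y v) * k)               ≡⟨ ∑𝟙*k≡k*∣p∣ k Y ⟩
    k * ∣ Y ∣                                     ∎
    where open ≤-Reasoning

  limitedPacking⇒[δ+1]*∣X∣≤k*n : ∀ {δ k X} → (∀ v → δ ≤ deg G v) → IsLimitedPacking G k X →
    (δ + 1) * ∣ X ∣ ≤ k * n
  limitedPacking⇒[δ+1]*∣X∣≤k*n {δ} {k} {X} δ≤deg X-packing =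
    subst (λ t → (δ + 1) * ∣ X ∣ ≤ k * t) (∣⊤∣≡n n) (limitedPacking⇒m*∣X∣≤k*∣Y∣ X-packing δ+1≤∣N[v]∣)
    where
    δ+1≤∣N[v]∣ : ∀ v → δ + 1 ≤ ∣ N[ G ] v ∩ ⊤ ∣
    δ+1≤∣N[v]∣ v = subst₂ _≤_ (+-comm 1 δ) (sym (∣N[v]∣≡1+deg v)) (s≤s (δ≤deg v))

[δ+1]L≤kn⇒[δ∸k+1]n≤[δ+1][n∸L] : ∀ {δ k n L} → k ≤ δ → (δ + 1) * L ≤ k * n →
  (δ ∸ k + 1) * n ≤ (δ + 1) * (n ∸ L)
[δ+1]L≤kn⇒[δ∸k+1]n≤[δ+1][n∸L] {δ} {k} {n} {L} k≤δ [δ+1]L≤kn = begin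
  (δ ∸ k + 1) * n             ≡⟨ cong (_* n) (+-∸-comm 1 k≤δ) ⟨
  (δ + 1 ∸ k) * n             ≡⟨ *-distribʳ-∸ n (δ + 1) k ⟩
  (δ + 1) * n ∸ k * n         ≤⟨ ∸-monoʳ-≤ ((δ + 1) * n) [δ+1]L≤kn ⟩
  (δ + 1) * n ∸ (δ + 1) * L   ≡⟨ *-distribˡ-∸ (δ + 1) n L ⟨
  (δ + 1) * (n ∸ L)           ∎
  where open ≤-Reasoning

-- Both 1 + d and d + 1 occur so that the conclusion matches theorem6 verbatim.
power-bound : ∀ d c {a b m} → d * a ≤ m * b → 1 ≤ m → m ^ (d + 1) ≤ c * (d + 1) ^ (d + 1) →
              (d * a) ^ d ≤ b ^ d * (c * (1 + d) ^ (d + 1))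
power-bound d c {a} {b} {m} da≤mb 1≤m m^[d+1]≤c[d+1]^[d+1] = begin
  (d * a) ^ d                      ≤⟨ ^-monoˡ-≤ d da≤mb ⟩
  (m * b) ^ d                      ≡⟨ ^-distribʳ-* m b d ⟩
  m ^ d * b ^ d                    ≤⟨ *-monoˡ-≤ (b ^ d) (^-monoʳ-≤ m {{>-nonZero 1≤m}} (m≤m+n d 1)) ⟩
  m ^ (d + 1) * b ^ d              ≤⟨ *-monoˡ-≤ (b ^ d) m^[d+1]≤c[d+1]^[d+1] ⟩
  c * (d + 1) ^ (d + 1) * b ^ d    ≡⟨ cong (λ e → c * e ^ (d + 1) * b ^ d) (+-comm d 1) ⟩
  c * (1 + d) ^ (d + 1) * b ^ d    ≡⟨ *-comm _ (b ^ d) ⟩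
  b ^ d * (c * (1 + d) ^ (d + 1))  ∎
  where open ≤-Reasoning

[δ∸k+2]+[k∸1]≡δ+1 : ∀ {δ k} → 1 ≤ k → k ≤ δ → δ ∸ k + 1 + 1 + (k ∸ 1) ≡ δ + 1
[δ∸k+2]+[k∸1]≡δ+1 {δ} {suc k} _ k≤δ = trans (rearrange (δ ∸ suc k) k) (cong (_+ 1) (m∸n+n≡m k≤δ))
  where
  rearrange : ∀ t j → t + 1 + 1 + j ≡ t + suc j + 1
  rearrange = solve-∀

theorem6 : ∀ (n : ℕ) (G : Graph n) (δ k L γ : ℕ) →
    IsMinDegree G δ → 1 ≤ k → k ∸ 1 ≤ δ →
    IsLk G k L → IsGammaTuple G k γ →
    L ≤ γ ×
    (k ≤ δ →
      ((δ ∸ k + 1) * n) ^ (δ ∸ k + 1)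
        ≤ (n ∸ L) ^ (δ ∸ k + 1) * (((δ + 1) C (k ∸ 1)) * (1 + (δ ∸ k + 1)) ^ ((δ ∸ k + 1) + 1)))
theorem6 n G δ k L γ (δ≤deg , _) 1≤k _ ((X , X-packing , ∣X∣≡L) , _) ((D , D-dominating , ∣D∣≡γ) , _) =
  L≤γ , λ k≤δ →
    power-bound (δ ∸ k + 1) ((δ + 1) C (k ∸ 1))
      ([δ+1]L≤kn⇒[δ∸k+1]n≤[δ+1][n∸L] k≤δ [δ+1]L≤kn)
      (m≤n+m 1 δ)
      (m^k≤mCj*k^k (δ ∸ k + 1 + 1) (k ∸ 1) ([δ∸k+2]+[k∸1]≡δ+1 1≤k k≤δ))
  where
  L≤γ : L ≤ γ
  L≤γ = subst₂ _≤_ ∣X∣≡L ∣D∣≡γ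
    (*-cancelˡ-≤ k {{>-nonZero 1≤k}} (limitedPacking⇒m*∣X∣≤k*∣Y∣ G X-packing D-dominating))
  [δ+1]L≤kn : (δ + 1) * L ≤ k * n
  [δ+1]L≤kn = subst (λ x → (δ + 1) * x ≤ k * n) ∣X∣≡L (limitedPacking⇒[δ+1]*∣X∣≤k*n G δ≤deg X-packing)
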